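{- Let $m\neq n$ be positive integers, let $s$ be a finite nonempty sequence of positive integers, and let $k\ge j>0$. Let $t^{(1)},t^{(2)}\in\{m,n\}^k$. Then $t^{(1)}$ and $t^{(2)}$ agree in their first $j$ terms if and only if $C_{m,n}(s,t^{(1)})$ and $C_{m,n}(s,t^{(2)})$ agree in their first $j$ terms.
   Context: For a (possibly infinite) sequence $s$, $R(s)$ denotes the sequence of run lengths of $s$ (the lengths of the maximal blocks of consecutive equal terms, in order). Let $m\neq n$ be positive integers. For a sequence $s$ of positive integers and a finite nonempty sequence $t=(t_1,\dots,t_k)$ with values in $\{m,n\}$, the expansion $E_{m,n}(s,t)$ is defined recursively: if $k=1$, $E_{m,n}(s,t)$ is the unique sequence with values in $\{m,n\}$ whose first term is $t_1$ and with $R(E_{m,n}(s,t))=s$; if $k>1$, $E_{m,n}(s,t)=E_{m,n}(E_{m,n}(s,(t_1)),(t_2,\dots,t_k))$. For a finite nonempty sequence $s$ of positive integers and $t\in\{m,n\}^k$, $C_{m,n}(s,t)$ is the sequence of length $k$ whose $i$-th term equals $m+n$ minus the last term of $E_{m,n}(s,(t_1,\dots,t_i))$. $\{m,n\}^k$ is the set of length-$k$ sequences with values in $\{m,n\}$. -}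

module Defs where

open import Data.Nat using (ℕ; zero; suc; _+_; _∸_)
open import Data.List using (List; []; _∷_; _++_; replicate; map; take; length; upTo)

-- Values in {m,n}: the "other" value of x ∈ {m,n} is m + n ∸ x.

-- The unique sequence with first term a, alternating between a and b,
-- whose run-length sequence is s (for s with positive entries).
alternate : ℕ → ℕ → List ℕ → List ℕ
alternate a b []       = []
alternate a b (x ∷ xs) = replicate x a ++ alternate b a xs

E₁ : ℕ → ℕ → List ℕ → ℕ → List ℕ
E₁ m n s t₁ = alternate t₁ (m + n ∸ t₁) s

E : ℕ → ℕ → List ℕ → List ℕ → List ℕ
E m n s []            = s
E m n s (t₁ ∷ [])     = E₁ m n s t₁
E m n s (t₁ ∷ t₂ ∷ ts) = E m n (E₁ m n s t₁) (t₂ ∷ ts)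

-- last term of a list (default 0 on the empty list; never used
-- in the theorem since the relevant sequences are nonempty)
lastOr0 : List ℕ → ℕ
lastOr0 []           = 0
lastOr0 (x ∷ [])     = x
lastOr0 (x ∷ y ∷ xs) = lastOr0 (y ∷ xs)

-- C_{m,n}(s,t): i-th term (i = 1..k) is m + n minus the last term of
-- E_{m,n}(s,(t₁,…,t_i)).
C : ℕ → ℕ → List ℕ → List ℕ → List ℕ
C m n s t = map (λ i → m + n ∸ lastOr0 (E m n s (take (suc i) t))) (upTo (length t))

-- The i-th term of C(s,t) only depends on t₁, …, t_i, which gives "⇒".  For "⇐",
-- the first term of C(s,t) determines t₁: the last term of E(s,(t₁)) is t₁ or its
-- complement m + n − t₁, according to the parity of the length of s, and both maps
-- are injective on {m,n}.  Since C(s, t₁ ∷ t) = (m + n − last E(s,(t₁))) ∷ C(E(s,(t₁)), t),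
-- induction on j with s replaced by E(s,(t₁)) finishes the argument.
module Submission where

open import Defs
open import Data.Nat using (ℕ; _<_; _≤_; zero; suc; _+_; _∸_; s≤s)
open import Data.Nat.Properties using (m≤m+n; m≤n+m; ∸-cancelˡ-≡; m∸[m∸n]≡n; m+n∸m≡n; m+n∸n≡m)
open import Data.List using (List; []; _∷_; _++_; take; length; map; applyUpTo; upTo; replicate)
open import Data.List.Properties using (map-applyUpTo; ++-identityʳ; ∷-injective)
open import Data.List.Relation.Unary.All using (All; []; _∷_)
open import Data.List.Relation.Unary.All.Properties using (++⁺; replicate⁺)
open import Data.Sum using (_⊎_; inj₁; inj₂)
open import Data.Product using (_,_)
open import Data.Empty using (⊥-elim)
open import Relation.Binary.PropositionalEquality
open import Function.Bundles using (_⇔_; mk⇔)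

Positive : List ℕ → Set
Positive = All (0 <_)

OneOf : ℕ → ℕ → ℕ → Set
OneOf m n x = x ≡ m ⊎ x ≡ n

OneOf-complement : ∀ {m n a} → OneOf m n a → OneOf m n (m + n ∸ a)
OneOf-complement {m} {n} (inj₁ refl) = inj₂ (m+n∸m≡n m n)
OneOf-complement {m} {n} (inj₂ refl) = inj₁ (m+n∸n≡m m n)

OneOf-≤ : ∀ {m n a} → OneOf m n a → a ≤ m + n
OneOf-≤ {m} {n} (inj₁ refl) = m≤m+n m n
OneOf-≤ {m} {n} (inj₂ refl) = m≤n+m n m

OneOf-positive : ∀ {m n a} → 0 < m → 0 < n → OneOf m n a → 0 < a
OneOf-positive 0<m _ (inj₁ refl) = 0<m
OneOf-positive _ 0<n (inj₂ refl) = 0<n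

lastOr0-++ : ∀ xs {ys} → ys ≢ [] → lastOr0 (xs ++ ys) ≡ lastOr0 ys
lastOr0-++ []                     _    = refl
lastOr0-++ (x ∷ [])     {[]}      ys≢[] = ⊥-elim (ys≢[] refl)
lastOr0-++ (x ∷ [])     {y ∷ ys}  _     = refl
lastOr0-++ (x ∷ x′ ∷ xs)          ys≢[] = lastOr0-++ (x′ ∷ xs) ys≢[]

lastOr0-replicate : ∀ k a → lastOr0 (replicate (suc k) a) ≡ a
lastOr0-replicate zero    a = refl
lastOr0-replicate (suc k) a = lastOr0-replicate k a

alternate-≢[] : ∀ a b {s} → s ≢ [] → Positive s → alternate a b s ≢ []
alternate-≢[] a b {[]}        s≢[] _             = ⊥-elim (s≢[] refl)
alternate-≢[] a b {suc k ∷ s} _    (s≤s _ ∷ _) ()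

alternate-positive : ∀ {a b} → 0 < a → 0 < b → ∀ s → Positive (alternate a b s)
alternate-positive 0<a 0<b []      = []
alternate-positive 0<a 0<b (k ∷ s) = ++⁺ (replicate⁺ k 0<a) (alternate-positive 0<b 0<a s)

lastOr0-alternate-swap : ∀ a b k k′ s → Positive (k′ ∷ s) →
  lastOr0 (alternate a b (k ∷ k′ ∷ s)) ≡ lastOr0 (alternate b a (k′ ∷ s))
lastOr0-alternate-swap a b k k′ s pos = lastOr0-++ (replicate k a) (alternate-≢[] b a (λ ()) pos)

lastOr0-alternate : ∀ {s} → s ≢ [] → Positive s →
  (∀ a b → lastOr0 (alternate a b s) ≡ a) ⊎ (∀ a b → lastOr0 (alternate a b s) ≡ b)
lastOr0-alternate {[]}         s≢[] _ = ⊥-elim (s≢[] refl)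
lastOr0-alternate {suc k ∷ []} _    _ = inj₁ λ a b →
  trans (cong lastOr0 (++-identityʳ (replicate (suc k) a))) (lastOr0-replicate k a)
lastOr0-alternate {k ∷ k′ ∷ s} _ (_ ∷ pos) with lastOr0-alternate {k′ ∷ s} (λ ()) pos
... | inj₁ last≡a = inj₂ λ a b → trans (lastOr0-alternate-swap a b k k′ s pos) (last≡a b a)
... | inj₂ last≡b = inj₁ λ a b → trans (lastOr0-alternate-swap a b k k′ s pos) (last≡b b a)

module _ (m n : ℕ) where

  head-C : List ℕ → ℕ → ℕ
  head-C s a = m + n ∸ lastOr0 (E₁ m n s a)

  C-∷ : ∀ s a t → C m n s (a ∷ t) ≡ head-C s a ∷ C m n (E₁ m n s a) t
  C-∷ s a []      = refl
  C-∷ s a (b ∷ t) = cong (head-C s a ∷_) (begin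
    map f (applyUpTo suc (suc (length t)))        ≡⟨ map-applyUpTo suc f (suc (length t)) ⟩
    applyUpTo (λ i → f (suc i)) (suc (length t))  ≡⟨ map-applyUpTo (λ i → i) g (suc (length t)) ⟨
    map g (upTo (suc (length t)))                 ∎)
    where
    open ≡-Reasoning
    f g : ℕ → ℕ
    f = λ i → m + n ∸ lastOr0 (E m n s (take (suc i) (a ∷ b ∷ t)))
    g = λ i → m + n ∸ lastOr0 (E m n (E₁ m n s a) (take (suc i) (b ∷ t)))

  take-C : ∀ j s t → take j (C m n s t) ≡ take j (C m n s (take j t))
  take-C zero    s t       = refl
  take-C (suc j) s []      = refl
  take-C (suc j) s (a ∷ t) = begin
    take (suc j) (C m n s (a ∷ t))                       ≡⟨ cong (take (suc j)) (C-∷ s a t) ⟩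
    head-C s a ∷ take j (C m n (E₁ m n s a) t)            ≡⟨ cong (head-C s a ∷_) (take-C j (E₁ m n s a) t) ⟩
    head-C s a ∷ take j (C m n (E₁ m n s a) (take j t))   ≡⟨ cong (take (suc j)) (C-∷ s a (take j t)) ⟨
    take (suc j) (C m n s (a ∷ take j t))                 ∎
    where open ≡-Reasoning

  head-C-injective : ∀ {s a b} → s ≢ [] → Positive s → OneOf m n a → OneOf m n b →
                     head-C s a ≡ head-C s b → a ≡ b
  head-C-injective {s} {a} {b} s≢[] pos a∈ b∈ eq with lastOr0-alternate s≢[] pos
  ... | inj₁ last≡a = ∸-cancelˡ-≡ (OneOf-≤ a∈) (OneOf-≤ b∈)
    (subst₂ (λ x y → m + n ∸ x ≡ m + n ∸ y) (last≡a a _) (last≡a b _) eq)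
  ... | inj₂ last≡b = begin
    a                                         ≡⟨ m∸[m∸n]≡n (OneOf-≤ a∈) ⟨
    m + n ∸ (m + n ∸ a)                       ≡⟨ cong (m + n ∸_) (last≡b a _) ⟨
    head-C s a                                ≡⟨ eq ⟩
    head-C s b                                ≡⟨ cong (m + n ∸_) (last≡b b _) ⟩
    m + n ∸ (m + n ∸ b)                       ≡⟨ m∸[m∸n]≡n (OneOf-≤ b∈) ⟩
    b                                         ∎
    where open ≡-Reasoning

  take-C-injective : 0 < m → 0 < n → ∀ j {s} → s ≢ [] → Positive s →
    ∀ {t₁ t₂} → All (OneOf m n) t₁ → All (OneOf m n) t₂ →
    take j (C m n s t₁) ≡ take j (C m n s t₂) → take j t₁ ≡ take j t₂
  take-C-injective _ _ zero _ _ _ _ _ = refl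
  take-C-injective _ _ (suc j) _ _ {[]}     {[]}     _ _ _ = refl
  take-C-injective _ _ (suc j) {s} _ _ {[]} {b ∷ t₂} _ _ eq
    with () ← trans eq (cong (take (suc j)) (C-∷ s b t₂))
  take-C-injective _ _ (suc j) {s} _ _ {a ∷ t₁} {[]} _ _ eq
    with () ← trans (sym eq) (cong (take (suc j)) (C-∷ s a t₁))
  take-C-injective 0<m 0<n (suc j) {s} s≢[] pos {a ∷ t₁} {b ∷ t₂} (a∈ ∷ t₁∈) (b∈ ∷ t₂∈) eq
    with heads , tails ← ∷-injective (trans (sym (cong (take (suc j)) (C-∷ s a t₁)))
                                     (trans eq (cong (take (suc j)) (C-∷ s b t₂))))
    with refl ← head-C-injective s≢[] pos a∈ b∈ heads
    = cong (a ∷_) (take-C-injective 0<m 0<n j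
        (alternate-≢[] a _ s≢[] pos)
        (alternate-positive (OneOf-positive 0<m 0<n a∈)
                            (OneOf-positive 0<m 0<n (OneOf-complement a∈)) s)
        t₁∈ t₂∈ tails)

proposition3p1 : (m n : ℕ) → 0 < m → 0 < n → m ≢ n →
    (s : List ℕ) → s ≢ [] → All (λ x → 0 < x) s →
    (k j : ℕ) → 0 < j → j ≤ k →
    (t₁ t₂ : List ℕ) → length t₁ ≡ k → length t₂ ≡ k →
    All (λ x → x ≡ m ⊎ x ≡ n) t₁ → All (λ x → x ≡ m ⊎ x ≡ n) t₂ →
    (take j t₁ ≡ take j t₂) ⇔ (take j (C m n s t₁) ≡ take j (C m n s t₂))
proposition3p1 m n 0<m 0<n _ s s≢[] pos k j _ _ t₁ t₂ _ _ t₁∈ t₂∈ =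
  mk⇔ prefix⇒ (take-C-injective m n 0<m 0<n j s≢[] pos t₁∈ t₂∈)
  where
  open ≡-Reasoning
  prefix⇒ : take j t₁ ≡ take j t₂ → take j (C m n s t₁) ≡ take j (C m n s t₂)
  prefix⇒ eq = begin
    take j (C m n s t₁)             ≡⟨ take-C m n j s t₁ ⟩
    take j (C m n s (take j t₁))    ≡⟨ cong (λ t → take j (C m n s t)) eq ⟩
    take j (C m n s (take j t₂))    ≡⟨ take-C m n j s t₂ ⟨
    take j (C m n s t₂)             ∎
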